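{- Let $k$ be a positive integer and let $p$ be a prime with $p\equiv 3 \pmod 4$. Let $r$ be a non-negative integer such that $p$ divides $4r+3$. Then for all integers $n\geq 0$, $$\bar{B}_{5,4}\left(4p^{k+1}n+4pr+3p\right)\equiv f(p)\cdot \bar{B}_{5,4}\left(4p^{k-1}n+\frac{4r+3}{p}\right) \pmod 4,$$ where $f(p)=-1$ if $p\equiv 3,7 \pmod{20}$ and $f(p)=1$ if $p\equiv 11,19 \pmod{20}$.
   Context: An overpartition of a positive integer $n$ is a partition of $n$ in which the first occurrence of each distinct part may be overlined. For coprime integers $\ell_1,\ell_2>1$, $\bar{B}_{\ell_1,\ell_2}(n)$ denotes the number of overpartitions of $n$ in which no part is divisible by $\ell_1$ or by $\ell_2$, with $\bar{B}_{\ell_1,\ell_2}(0)=1$. -}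

module Defs where

open import Data.Nat using (ℕ; zero; suc; _+_; _*_; _∸_; _≤ᵇ_; _≡ᵇ_; _%_)
open import Data.Bool using (Bool; true; false; if_then_else_; _∨_; not)
open import Data.List using (List; []; _∷_; _++_; length; replicate; concatMap; upTo)
open import Data.Product using (_×_; _,_)
open import Data.Integer as ℤ using (ℤ; +_)

-- A part of an overpartition: (size, overlined?).
-- An overpartition is represented as the list of its parts (with flags),
-- in non-increasing order of size, where only the first occurrence of a
-- part size may carry the flag 'true' (overlined).
Part : Set
Part = ℕ × Bool

Overpartition : Set
Overpartition = List Part

allowed54 : ℕ → Bool
allowed54 m = not ((m % 5) ≡ᵇ 0) Data.Bool.∧ not ((m % 4) ≡ᵇ 0)
  where open import Data.Bool using (_∧_)

block : ℕ → ℕ → Bool → Overpartition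
block s zero    b = []
block s (suc j) b = (s , b) ∷ replicate j (s , false)

-- gen m n : the list of ALL overpartitions of n whose parts are ≤ m
-- and allowed (not divisible by 5 or 4).  Each is produced exactly once:
-- for the largest admissible size s = suc m we choose its multiplicity j
-- (0 ≤ j, j*s ≤ n) and, when j ≥ 1, whether its first occurrence is overlined.
gen : ℕ → ℕ → List Overpartition
gen zero    zero    = [] ∷ []
gen zero    (suc n) = []
gen (suc m) n =
  if allowed54 (suc m)
  then concatMap choose (upTo (suc n))
  else gen m n
  where
  choose : ℕ → List Overpartition
  choose zero = gen m n
  choose (suc j) =
    if (suc j * suc m) ≤ᵇ n
    then concatMap (λ rest → (block (suc m) (suc j) false ++ rest)
                            ∷ (block (suc m) (suc j) true ++ rest) ∷ [])
                   (gen m (n ∸ suc j * suc m))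
    else []

-- B̄_{5,4}(n): the number of overpartitions of n with no part divisible
-- by 5 or by 4 (parts of an overpartition of n are ≤ n).  B̄_{5,4}(0) = 1.
B̄₅₄ : ℕ → ℕ
B̄₅₄ n = length (gen n n)

-- f(p) = -1 if p ≡ 3,7 (mod 20), and 1 if p ≡ 11,19 (mod 20).
-- (For primes p ≡ 3 (mod 4) these are the only possible residues.)
f : ℕ → ℤ
f p = if ((p % 20) ≡ᵇ 3) ∨ ((p % 20) ≡ᵇ 7) then ℤ.-[1+ 0 ] else + 1

module Submission where

-- Modulo 4 the generating function ∏ (1 + qᵐ)/(1 − qᵐ) over the allowed m (those not divisible by
-- 4 or 5) is ∏ (1 + 2 ∑ⱼ qʲᵐ) ≡ 1 + 2 ∑ₘ ∑ⱼ qʲᵐ, so B̄₅₄(n) ≡ 2 d(n) (mod 4) for n ≥ 1, where d(n)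
-- counts the allowed divisors of n. For a prime p coprime to 20 the allowed divisors of p²B are
-- those of B together with two equinumerous sets: the divisors of pB not dividing B, and p times
-- them. So d(p²B) ≡ d(B) (mod 2) and B̄₅₄(p²B) ≡ B̄₅₄(B) (mod 4); since B̄₅₄(B) is even, it is
-- also ≡ −B̄₅₄(B), which makes the sign f(p) immaterial. The theorem is the case
-- B = 4p^(k−1)n + (4r+3)/p, for which p²B = 4p^(k+1)n + 4pr + 3p.

open import Data.Bool using (Bool; true; false; not; _∧_; _∨_; if_then_else_)
open import Data.Bool.Properties using (∧-identityʳ; ∧-zeroʳ; if-float)
open import Data.Integer using (+_; -[1+_]; _-_)
import Data.Integer as ℤ
import Data.Integer.Properties as ℤ
open import Data.Integer.Divisibility using () renaming (_∣_ to _∣ℤ_)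
import Data.Integer.Divisibility.Signed as ℤ∣
import Data.Integer.Tactic.RingSolver as ℤ-Solver
open import Data.List using (List; []; _∷_; _++_; length; concatMap; applyUpTo)
open import Data.List.Properties using (length-++)
open import Data.Nat
open import Data.Nat.Coprimality using (Coprime; coprime-divisor)
open import Data.Nat.DivMod using (m*n/n≡m)
open import Data.Nat.Divisibility
open import Data.Nat.Primality using (Prime; prime⇒nonZero; prime⇒irreducible)
open import Data.Nat.Properties
open import Algebra.Properties.CommutativeSemigroup +-commutativeSemigroup using (interchange)
import Data.Nat.Tactic.RingSolver as ℕ-Solver
open import Data.Product using (_×_; _,_; proj₁; proj₂)
open import Data.Sum using (_⊎_; inj₁; inj₂)
open import Function using (_∘_)
open import Function.Bundles using (mk⇔)
open import Level using (0ℓ)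
open import Relation.Binary.Bundles using (Setoid)
open import Relation.Binary.PropositionalEquality
open import Relation.Nullary using (Dec; yes; no; does; contradiction)
open import Relation.Nullary.Decidable using (dec-true; dec-false; does-⇔; from-no)
open import Relation.Nullary.Reflects using (ofʸ; ofⁿ)

open import Defs

-- Finite sums

∑< : ℕ → (ℕ → ℕ) → ℕ
∑< zero    h = 0
∑< (suc n) h = ∑< n h + h n

syntax ∑< n (λ i → e) = ∑[ i < n ] e

module _ {g h : ℕ → ℕ} where

  ∑-cong : ∀ n → (∀ i → g i ≡ h i) → ∑< n g ≡ ∑< n h
  ∑-cong zero    _   = refl
  ∑-cong (suc n) g≗h = cong₂ _+_ (∑-cong n g≗h) (g≗h n)

  ∑-+ : ∀ n → ∑[ i < n ] (g i + h i) ≡ ∑< n g + ∑< n h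
  ∑-+ zero    = refl
  ∑-+ (suc n) = trans (cong (_+ (g n + h n)) (∑-+ n)) (interchange (∑< n g) (∑< n h) (g n) (h n))

∑-*ˡ : ∀ m n (h : ℕ → ℕ) → ∑[ i < n ] (m * h i) ≡ m * ∑< n h
∑-*ˡ m zero    h = sym (*-zeroʳ m)
∑-*ˡ m (suc n) h = trans (cong (_+ m * h n) (∑-*ˡ m n h)) (sym (*-distribˡ-+ m _ (h n)))

∑-split : ∀ m n (h : ℕ → ℕ) → ∑< (m + n) h ≡ ∑< m h + ∑[ i < n ] h (m + i)
∑-split m zero    h = trans (cong (λ k → ∑< k h) (+-identityʳ m)) (sym (+-identityʳ _))
∑-split m (suc n) h = begin
  ∑< (m + suc n) h                            ≡⟨ cong (λ k → ∑< k h) (+-suc m n) ⟩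
  ∑< (m + n) h + h (m + n)                    ≡⟨ cong (_+ h (m + n)) (∑-split m n h) ⟩
  ∑< m h + ∑[ i < n ] h (m + i) + h (m + n)   ≡⟨ +-assoc (∑< m h) _ _ ⟩
  ∑< m h + ∑[ i < suc n ] h (m + i)           ∎
  where open ≡-Reasoning

∑-zero : ∀ n {h : ℕ → ℕ} → (∀ {i} → i < n → h i ≡ 0) → ∑< n h ≡ 0
∑-zero zero    _  = refl
∑-zero (suc n) h0 = cong₂ _+_ (∑-zero n (h0 ∘ m<n⇒m<1+n)) (h0 (n<1+n n))

∑-single : ∀ n {h : ℕ → ℕ} {j} → j < n → (∀ {i} → i < n → i ≢ j → h i ≡ 0) → ∑< n h ≡ h j
∑-single (suc n) {h} {j} j<1+n h0 with m≤n⇒m<n∨m≡n (s≤s⁻¹ j<1+n)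
... | inj₁ j<n = trans (cong₂ _+_ (∑-single n j<n (h0 ∘ m<n⇒m<1+n)) (h0 (n<1+n n) (>⇒≢ j<n)))
                       (+-identityʳ (h j))
... | inj₂ refl = cong (_+ h j) (∑-zero n (λ i<n → h0 (m<n⇒m<1+n i<n) (<⇒≢ i<n)))

∑-extend : ∀ {m n} {h : ℕ → ℕ} → m ≤ n → (∀ {i} → m ≤ i → h i ≡ 0) → ∑< n h ≡ ∑< m h
∑-extend {n = zero}  z≤n _  = refl
∑-extend {n = suc n} m≤1+n h0 with m≤n⇒m<n∨m≡n m≤1+n
... | inj₁ m<1+n = trans (cong₂ _+_ (∑-extend (s≤s⁻¹ m<1+n) h0) (h0 (s≤s⁻¹ m<1+n))) (+-identityʳ _)
... | inj₂ refl  = refl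

-- Of each block p * d ≤ i < p * (d + 1) only the first term survives.
∑-multiples : ∀ p M .{{_ : NonZero p}} {h : ℕ → ℕ} → (∀ {i} → p ∤ i → h i ≡ 0) →
              ∑< (p * M) h ≡ ∑[ d < M ] h (p * d)
∑-multiples p zero    {h} _  = cong (λ k → ∑< k h) (*-zeroʳ p)
∑-multiples p (suc M) {h} h0 = begin
  ∑< (p * suc M) h                          ≡⟨ cong (λ k → ∑< k h) (trans (*-suc p M) (+-comm p (p * M))) ⟩
  ∑< (p * M + p) h                          ≡⟨ ∑-split (p * M) p h ⟩
  ∑< (p * M) h + ∑[ i < p ] h (p * M + i)   ≡⟨ cong₂ _+_ (∑-multiples p M h0) last-block ⟩
  ∑[ d < M ] h (p * d) + h (p * M)          ∎
  where
  open ≡-Reasoning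
  last-block : ∑[ i < p ] h (p * M + i) ≡ h (p * M)
  last-block = trans (∑-single p (>-nonZero⁻¹ p) off) (cong h (+-identityʳ (p * M)))
    where
    off : ∀ {i} → i < p → i ≢ 0 → h (p * M + i) ≡ 0
    off {i} i<p i≢0 = h0 λ p∣pM+i →
      <⇒≱ i<p (∣⇒≤ ⦃ ≢-nonZero i≢0 ⦄ (∣m+n∣m⇒∣n p∣pM+i (m∣m*n M)))

-- Congruences of natural numbers

infix 4 _≡_mod_

-- A record rather than a definition, so that unification can still read off a, b and k.
record _≡_mod_ (a b k : ℕ) : Set where
  constructor ≡-mod
  field
    ∣-difference : + k ℤ∣.∣ (+ a - + b)

module _ {k : ℕ} where

  ≡-mod-refl : ∀ {a} → a ≡ a mod k
  ≡-mod-refl {a} = ≡-mod (subst (+ k ℤ∣.∣_) (sym (ℤ.+-inverseʳ (+ a))) (ℤ∣.divides (+ 0) refl))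

  ≡-mod-sym : ∀ {a b} → a ≡ b mod k → b ≡ a mod k
  ≡-mod-sym {a} {b} (≡-mod k∣a-b) = ≡-mod (subst (+ k ℤ∣.∣_) (swap (+ a) (+ b)) (ℤ∣.∣m⇒∣-m k∣a-b))
    where
    swap : ∀ x y → ℤ.- (x - y) ≡ y - x
    swap = ℤ-Solver.solve-∀

  ≡-mod-trans : ∀ {a b c} → a ≡ b mod k → b ≡ c mod k → a ≡ c mod k
  ≡-mod-trans {a} {b} {c} (≡-mod k∣a-b) (≡-mod k∣b-c) =
    ≡-mod (subst (+ k ℤ∣.∣_) (telescope (+ a) (+ b) (+ c)) (ℤ∣.∣m∣n⇒∣m+n k∣a-b k∣b-c))
    where
    telescope : ∀ x y z → (x - y) ℤ.+ (y - z) ≡ x - z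
    telescope = ℤ-Solver.solve-∀

  ≡-mod-+ : ∀ {a b c d} → a ≡ b mod k → c ≡ d mod k → a + c ≡ b + d mod k
  ≡-mod-+ {a} {b} {c} {d} (≡-mod k∣a-b) (≡-mod k∣c-d) =
    ≡-mod (subst (+ k ℤ∣.∣_) (regroup (+ a) (+ b) (+ c) (+ d)) (ℤ∣.∣m∣n⇒∣m+n k∣a-b k∣c-d))
    where
    regroup : ∀ w x y z → (w - x) ℤ.+ (y - z) ≡ (w ℤ.+ y) - (x ℤ.+ z)
    regroup = ℤ-Solver.solve-∀

  ≡-mod-*ˡ : ∀ m {a b} → a ≡ b mod k → m * a ≡ m * b mod k
  ≡-mod-*ˡ m {a} {b} (≡-mod k∣a-b) = ≡-mod (subst (+ k ℤ∣.∣_) eq (ℤ∣.∣n⇒∣m*n (+ m) k∣a-b))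
    where
    distrib : ∀ x y z → x ℤ.* (y - z) ≡ x ℤ.* y - x ℤ.* z
    distrib = ℤ-Solver.solve-∀
    eq : + m ℤ.* (+ a - + b) ≡ + (m * a) - + (m * b)
    eq = trans (distrib (+ m) (+ a) (+ b)) (sym (cong₂ _-_ (ℤ.pos-* m a) (ℤ.pos-* m b)))

  ≡-mod-+-multiple : ∀ a d → a + k * d ≡ a mod k
  ≡-mod-+-multiple a d = ≡-mod
    (ℤ∣.divides (+ d) (trans (cong (λ z → + a ℤ.+ z - + a) (ℤ.pos-* k d)) (cancel (+ a) (+ k) (+ d))))
    where
    cancel : ∀ x y z → (x ℤ.+ y ℤ.* z) - x ≡ z ℤ.* y
    cancel = ℤ-Solver.solve-∀

  ≡-mod-if : ∀ b {x y} → x ≡ y mod k → (if b then x else 0) ≡ (if b then y else 0) mod k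
  ≡-mod-if true  x≡y = x≡y
  ≡-mod-if false _   = ≡-mod-refl

  ≡-mod-∑ : ∀ n {g h : ℕ → ℕ} → (∀ i → g i ≡ h i mod k) → ∑< n g ≡ ∑< n h mod k
  ≡-mod-∑ zero    _   = ≡-mod-refl
  ≡-mod-∑ (suc n) g≡h = ≡-mod-+ (≡-mod-∑ n g≡h) (g≡h n)

≡-mod-setoid : ℕ → Setoid 0ℓ 0ℓ
≡-mod-setoid k = record
  { Carrier       = ℕ
  ; _≈_           = _≡_mod k
  ; isEquivalence = record { refl = ≡-mod-refl ; sym = ≡-mod-sym ; trans = ≡-mod-trans }
  }

module ≡-mod-Reasoning (k : ℕ) where
  open import Relation.Binary.Reasoning.Setoid (≡-mod-setoid k) public

-- Divisibility tests

⟦_⟧ : Bool → ℕ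
⟦ true  ⟧ = 1
⟦ false ⟧ = 0

if-then-⟦∧⟧ : ∀ b {x c} → x ≡ ⟦ c ⟧ → (if b then x else 0) ≡ ⟦ b ∧ c ⟧
if-then-⟦∧⟧ true  x≡c = x≡c
if-then-⟦∧⟧ false _   = refl

⟦∧false⟧ : ∀ b {c} → c ≡ false → ⟦ b ∧ c ⟧ ≡ 0
⟦∧false⟧ b refl = cong ⟦_⟧ (∧-zeroʳ b)

⟦∧⟧-split : ∀ b {X Y : Set} (x? : Dec X) (y? : Dec Y) → (X → Y) →
            ⟦ b ∧ does y? ⟧ ≡ ⟦ b ∧ does x? ⟧ + ⟦ b ∧ (does y? ∧ not (does x?)) ⟧
⟦∧⟧-split false x?      y? _   = refl
⟦∧⟧-split true  (no _)  y? _   = cong ⟦_⟧ (sym (∧-identityʳ (does y?)))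
⟦∧⟧-split true  (yes x) y? x⇒y rewrite dec-true y? (x⇒y x) = refl

∣?-above : ∀ {d n} → 0 < n → n < d → does (d ∣? n) ≡ false
∣?-above 0<n n<d = dec-false (_ ∣? _) λ d∣n → <⇒≱ n<d (∣⇒≤ ⦃ >-nonZero 0<n ⦄ d∣n)

∣?-*-cancel : ∀ p d x .{{_ : NonZero p}} → does (p * d ∣? p * x) ≡ does (d ∣? x)
∣?-*-cancel p d x = does-⇔ (mk⇔ (*-cancelˡ-∣ p) (*-monoʳ-∣ p)) (p * d ∣? p * x) (d ∣? x)

∣?-*-coprime : ∀ {q p} d → Coprime q p → does (q ∣? p * d) ≡ does (q ∣? d)
∣?-*-coprime {q} {p} d q⊥p = does-⇔ (mk⇔ (coprime-divisor q⊥p) (∣n⇒∣m*n p)) (q ∣? p * d) (q ∣? d)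

prime-coprime : ∀ {p q} → Prime p → p ∤ q → Coprime q p
prime-coprime p-prime p∤q (d∣q , d∣p) with prime⇒irreducible p-prime d∣p
... | inj₁ d≡1 = d≡1
... | inj₂ refl = contradiction d∣q p∤q

-- allowed54 m unfolds to not (does (5 ∣? m)) ∧ not (does (4 ∣? m)).
allowed54-* : ∀ {p} d → Coprime 4 p → Coprime 5 p → allowed54 (p * d) ≡ allowed54 d
allowed54-* d 4⊥p 5⊥p =
  cong₂ (λ x y → not x ∧ not y) (∣?-*-coprime d 5⊥p) (∣?-*-coprime d 4⊥p)

-- Counting overpartitions modulo 4

length-concatMap-applyUpTo : ∀ {A B : Set} (g : A → List B) (f : ℕ → A) n →
                             length (concatMap g (applyUpTo f n)) ≡ ∑[ i < n ] length (g (f i))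
length-concatMap-applyUpTo g f zero    = refl
length-concatMap-applyUpTo g f (suc n) =
  trans (length-++ (g (f 0)))
        (trans (cong (_+_ (length (g (f 0)))) (length-concatMap-applyUpTo g (f ∘ suc) n))
               (sym (∑-split 1 n (λ i → length (g (f i))))))

length-pairs : ∀ {A B : Set} (u v : A → B) xs →
               length (concatMap (λ x → u x ∷ v x ∷ []) xs) ≡ 2 * length xs
length-pairs u v []       = refl
length-pairs u v (x ∷ xs) =
  cong suc (trans (cong suc (length-pairs u v xs)) (sym (+-suc (length xs) (length xs + 0))))

length-if : ∀ {A : Set} b (xs : List A) → length (if b then xs else []) ≡ (if b then length xs else 0)
length-if true  xs = refl
length-if false xs = refl

-- The overpartitions of n counted by gen (suc m) n in which suc m occurs exactly suc j times.
blocks : ℕ → ℕ → ℕ → ℕ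
blocks m n j = if suc j * suc m ≤ᵇ n then 2 * length (gen m (n ∸ suc j * suc m)) else 0

length-gen-suc : ∀ m n → length (gen (suc m) n) ≡
                 length (gen m n) + (if allowed54 (suc m) then ∑[ j < n ] blocks m n j else 0)
length-gen-suc m n with allowed54 (suc m)
... | false = sym (+-identityʳ _)
... | true  = trans (length-++ (gen m n)) (cong (_+_ (length (gen m n)))
                (trans (length-concatMap-applyUpTo _ suc n) (∑-cong n λ j →
                  trans (length-if (suc j * suc m ≤ᵇ n) _)
                        (cong (λ x → if suc j * suc m ≤ᵇ n then x else 0)
                              (length-pairs _ _ (gen m (n ∸ suc j * suc m)))))))

positiveQuotients : ℕ → ℕ → ℕ
positiveQuotients s n = ∑[ j < n ] ⟦ suc j * s ≡ᵇ n ⟧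

allowedFactorisations : ℕ → ℕ → ℕ
allowedFactorisations m n = ∑[ d < suc m ] (if allowed54 d then positiveQuotients d n else 0)

if-≤ᵇ-∸≡ᵇ0 : ∀ a n → (if a ≤ᵇ n then ⟦ n ∸ a ≡ᵇ 0 ⟧ else 0) ≡ ⟦ a ≡ᵇ n ⟧
if-≤ᵇ-∸≡ᵇ0 a n with a ≤ᵇ n | ≤ᵇ-reflects-≤ a n
... | true  | ofʸ a≤n = cong ⟦_⟧ (does-⇔ (mk⇔ (λ n∸a≡0 → ≤-antisym a≤n (m∸n≡0⇒m≤n n∸a≡0))
                                           (λ { refl → n∸n≡0 a }))
                                      (n ∸ a ≟ 0) (a ≟ n))
... | false | ofⁿ a≰n = cong ⟦_⟧ (sym (dec-false (a ≟ n) (a≰n ∘ ≤-reflexive)))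

length-gen-mod-4 : ∀ m n → length (gen m n) ≡ ⟦ n ≡ᵇ 0 ⟧ + 2 * allowedFactorisations m n mod 4
length-gen-mod-4 zero    zero    = ≡-mod-refl
length-gen-mod-4 zero    (suc n) = ≡-mod-refl
length-gen-mod-4 (suc m) n = begin
  length (gen (suc m) n)
    ≡⟨ length-gen-suc m n ⟩
  length (gen m n) + (if allowed54 (suc m) then ∑[ j < n ] blocks m n j else 0)
    ≈⟨ ≡-mod-+ (length-gen-mod-4 m n) (≡-mod-if (allowed54 (suc m)) ∑-blocks) ⟩
  ⟦ n ≡ᵇ 0 ⟧ + 2 * F + (if allowed54 (suc m) then 2 * Q else 0)
    ≡⟨ cong (_+_ (⟦ n ≡ᵇ 0 ⟧ + 2 * F)) (sym (if-float (2 *_) (allowed54 (suc m)))) ⟩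
  ⟦ n ≡ᵇ 0 ⟧ + 2 * F + 2 * (if allowed54 (suc m) then Q else 0)
    ≡⟨ regroup ⟦ n ≡ᵇ 0 ⟧ F _ ⟩
  ⟦ n ≡ᵇ 0 ⟧ + 2 * allowedFactorisations (suc m) n ∎
  where
  open ≡-mod-Reasoning 4
  F = allowedFactorisations m n
  Q = positiveQuotients (suc m) n

  regroup : ∀ a x y → a + 2 * x + 2 * y ≡ a + 2 * (x + y)
  regroup = ℕ-Solver.solve-∀

  double-length-gen : ∀ r → 2 * length (gen m r) ≡ 2 * ⟦ r ≡ᵇ 0 ⟧ mod 4
  double-length-gen r = begin
    2 * length (gen m r)               ≈⟨ ≡-mod-*ˡ 2 (length-gen-mod-4 m r) ⟩
    2 * (⟦ r ≡ᵇ 0 ⟧ + 2 * F′)          ≡⟨ distrib ⟦ r ≡ᵇ 0 ⟧ F′ ⟩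
    2 * ⟦ r ≡ᵇ 0 ⟧ + 4 * F′            ≈⟨ ≡-mod-+-multiple (2 * ⟦ r ≡ᵇ 0 ⟧) F′ ⟩
    2 * ⟦ r ≡ᵇ 0 ⟧                     ∎
    where
    F′ = allowedFactorisations m r
    distrib : ∀ a x → 2 * (a + 2 * x) ≡ 2 * a + 4 * x
    distrib = ℕ-Solver.solve-∀

  block-mod-4 : ∀ j → blocks m n j ≡ 2 * ⟦ suc j * suc m ≡ᵇ n ⟧ mod 4
  block-mod-4 j = begin
    blocks m n j                                  ≈⟨ ≡-mod-if (a ≤ᵇ n) (double-length-gen (n ∸ a)) ⟩
    (if a ≤ᵇ n then 2 * ⟦ n ∸ a ≡ᵇ 0 ⟧ else 0)    ≡⟨ sym (if-float (2 *_) (a ≤ᵇ n)) ⟩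
    2 * (if a ≤ᵇ n then ⟦ n ∸ a ≡ᵇ 0 ⟧ else 0)    ≡⟨ cong (2 *_) (if-≤ᵇ-∸≡ᵇ0 a n) ⟩
    2 * ⟦ a ≡ᵇ n ⟧                                ∎
    where a = suc j * suc m

  ∑-blocks : ∑[ j < n ] blocks m n j ≡ 2 * Q mod 4
  ∑-blocks = begin
    ∑[ j < n ] blocks m n j                       ≈⟨ ≡-mod-∑ n block-mod-4 ⟩
    ∑[ j < n ] (2 * ⟦ suc j * suc m ≡ᵇ n ⟧)       ≡⟨ ∑-*ˡ 2 n _ ⟩
    2 * Q                                         ∎

positiveQuotients-∣ : ∀ s n .{{_ : NonZero s}} → 0 < n → positiveQuotients s n ≡ ⟦ does (s ∣? n) ⟧
positiveQuotients-∣ s n 0<n with s ∣? n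
... | no s∤n = ∑-zero n λ {j} _ →
        cong ⟦_⟧ (dec-false (suc j * s ≟ n) λ j+1*s≡n → s∤n (divides (suc j) (sym j+1*s≡n)))
... | yes (divides zero    n≡0)   = contradiction n≡0 (>⇒≢ 0<n)
... | yes (divides (suc q) n≡q+1*s) =
        trans (∑-single n q<n others) (cong ⟦_⟧ (dec-true (suc q * s ≟ n) (sym n≡q+1*s)))
  where
  q<n : q < n
  q<n = subst (q <_) (sym n≡q+1*s) (m≤m*n (suc q) s)
  others : ∀ {i} → i < n → i ≢ q → ⟦ suc i * s ≡ᵇ n ⟧ ≡ 0
  others {i} _ i≢q = cong ⟦_⟧ (dec-false (suc i * s ≟ n) λ i+1*s≡n →
    i≢q (suc-injective (*-cancelʳ-≡ (suc i) (suc q) s (trans i+1*s≡n n≡q+1*s))))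

isAllowedDivisor : ℕ → ℕ → Bool
isAllowedDivisor n d = allowed54 d ∧ does (d ∣? n)

allowedDivisors : ℕ → ℕ
allowedDivisors n = ∑[ d < suc n ] ⟦ isAllowedDivisor n d ⟧

allowedFactorisations-divisors : ∀ n → 0 < n → allowedFactorisations n n ≡ allowedDivisors n
allowedFactorisations-divisors n 0<n = ∑-cong (suc n) term
  where
  term : ∀ d → (if allowed54 d then positiveQuotients d n else 0) ≡ ⟦ isAllowedDivisor n d ⟧
  term zero    = refl
  term (suc d) = if-then-⟦∧⟧ (allowed54 (suc d)) (positiveQuotients-∣ (suc d) n 0<n)

B̄₅₄-mod-4 : ∀ n → 0 < n → B̄₅₄ n ≡ 2 * allowedDivisors n mod 4
B̄₅₄-mod-4 n@(suc _) 0<n = begin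
  length (gen n n)                  ≈⟨ length-gen-mod-4 n n ⟩
  2 * allowedFactorisations n n     ≡⟨ cong (2 *_) (allowedFactorisations-divisors n 0<n) ⟩
  2 * allowedDivisors n             ∎
  where open ≡-mod-Reasoning 4

-- Divisors of p * n

isNewDivisor : ℕ → ℕ → ℕ → Bool
isNewDivisor p n d = allowed54 d ∧ (does (d ∣? p * n) ∧ not (does (d ∣? n)))

newDivisors : ℕ → ℕ → ℕ
newDivisors p n = ∑[ d < suc (p * n) ] ⟦ isNewDivisor p n d ⟧

allowedDivisors-* : ∀ p n .{{_ : NonZero p}} → 0 < n →
                    allowedDivisors (p * n) ≡ allowedDivisors n + newDivisors p n
allowedDivisors-* p n 0<n = begin
  ∑[ d < suc (p * n) ] ⟦ isAllowedDivisor (p * n) d ⟧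
    ≡⟨ ∑-cong (suc (p * n)) split ⟩
  ∑[ d < suc (p * n) ] (⟦ isAllowedDivisor n d ⟧ + ⟦ isNewDivisor p n d ⟧)
    ≡⟨ ∑-+ (suc (p * n)) ⟩
  ∑[ d < suc (p * n) ] ⟦ isAllowedDivisor n d ⟧ + newDivisors p n
    ≡⟨ cong (_+ newDivisors p n) (∑-extend (s≤s (m≤n*m n p)) beyond-n) ⟩
  allowedDivisors n + newDivisors p n ∎
  where
  open ≡-Reasoning
  split : ∀ d → ⟦ isAllowedDivisor (p * n) d ⟧ ≡ ⟦ isAllowedDivisor n d ⟧ + ⟦ isNewDivisor p n d ⟧
  split d = ⟦∧⟧-split (allowed54 d) (d ∣? n) (d ∣? p * n) (∣n⇒∣m*n p)
  beyond-n : ∀ {d} → suc n ≤ d → ⟦ isAllowedDivisor n d ⟧ ≡ 0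
  beyond-n n<d = ⟦∧false⟧ _ (∣?-above 0<n n<d)

-- For p prime, a divisor of p * (p * n) not dividing p * n is p times a divisor of p * n
-- not dividing n.
newDivisors-* : ∀ {p} n → Prime p → Coprime 4 p → Coprime 5 p → 0 < n →
                newDivisors p (p * n) ≡ newDivisors p n
newDivisors-* {p} n p-prime 4⊥p 5⊥p 0<n = begin
  ∑[ d < suc (p * (p * n)) ] ⟦ isNewDivisor p (p * n) d ⟧
    ≡⟨ sym (∑-extend bound beyond-p²n) ⟩
  ∑[ d < p * suc (p * n) ] ⟦ isNewDivisor p (p * n) d ⟧
    ≡⟨ ∑-multiples p (suc (p * n)) off-multiples ⟩
  ∑[ d < suc (p * n) ] ⟦ isNewDivisor p (p * n) (p * d) ⟧
    ≡⟨ ∑-cong (suc (p * n)) (cong ⟦_⟧ ∘ on-multiples) ⟩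
  newDivisors p n ∎
  where
  open ≡-Reasoning
  instance
    p≢0 : NonZero p
    p≢0 = prime⇒nonZero p-prime

  0<p²n : 0 < p * (p * n)
  0<p²n = <-≤-trans 0<n (≤-trans (m≤n*m n p) (m≤n*m (p * n) p))

  bound : suc (p * (p * n)) ≤ p * suc (p * n)
  bound = subst (suc (p * (p * n)) ≤_) (sym (*-suc p (p * n)))
                (+-monoˡ-≤ (p * (p * n)) (>-nonZero⁻¹ p))

  beyond-p²n : ∀ {d} → suc (p * (p * n)) ≤ d → ⟦ isNewDivisor p (p * n) d ⟧ ≡ 0
  beyond-p²n {d} p²n<d =
    ⟦∧false⟧ (allowed54 d) (cong (_∧ not (does (d ∣? p * n))) (∣?-above 0<p²n p²n<d))

  off-multiples : ∀ {e} → p ∤ e → ⟦ isNewDivisor p (p * n) e ⟧ ≡ 0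
  off-multiples {e} p∤e with e ∣? p * (p * n)
  ... | no  _      = ⟦∧false⟧ (allowed54 e) refl
  ... | yes e∣p²n = ⟦∧false⟧ (allowed54 e)
          (cong not (dec-true (e ∣? p * n) (coprime-divisor (prime-coprime p-prime p∤e) e∣p²n)))

  on-multiples : ∀ d → isNewDivisor p (p * n) (p * d) ≡ isNewDivisor p n d
  on-multiples d = cong₂ _∧_ (allowed54-* d 4⊥p 5⊥p)
    (cong₂ (λ x y → x ∧ not y) (∣?-*-cancel p d (p * n)) (∣?-*-cancel p d n))

allowedDivisors-*² : ∀ {p} n → Prime p → Coprime 4 p → Coprime 5 p → 0 < n →
                     allowedDivisors (p * (p * n)) ≡ allowedDivisors n + 2 * newDivisors p n
allowedDivisors-*² {p} n p-prime 4⊥p 5⊥p 0<n = begin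
  allowedDivisors (p * (p * n))                       ≡⟨ allowedDivisors-* p (p * n) 0<pn ⟩
  allowedDivisors (p * n) + newDivisors p (p * n)     ≡⟨ cong₂ _+_ (allowedDivisors-* p n 0<n)
                                                                   (newDivisors-* n p-prime 4⊥p 5⊥p 0<n) ⟩
  allowedDivisors n + new + new                       ≡⟨ double (allowedDivisors n) new ⟩
  allowedDivisors n + 2 * new                         ∎
  where
  open ≡-Reasoning
  double : ∀ a x → a + x + x ≡ a + 2 * x
  double = ℕ-Solver.solve-∀
  instance
    p≢0 : NonZero p
    p≢0 = prime⇒nonZero p-prime
  new = newDivisors p n
  0<pn : 0 < p * n
  0<pn = <-≤-trans 0<n (m≤n*m n p)

B̄₅₄-*-prime² : ∀ {p} n → Prime p → Coprime 4 p → Coprime 5 p → 0 < n →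
               B̄₅₄ (p * (p * n)) ≡ B̄₅₄ n mod 4
B̄₅₄-*-prime² {p} n p-prime 4⊥p 5⊥p 0<n = begin
  B̄₅₄ (p * (p * n))                          ≈⟨ B̄₅₄-mod-4 (p * (p * n)) 0<p²n ⟩
  2 * allowedDivisors (p * (p * n))          ≡⟨ cong (2 *_) (allowedDivisors-*² n p-prime 4⊥p 5⊥p 0<n) ⟩
  2 * (allowedDivisors n + 2 * new)          ≡⟨ distrib (allowedDivisors n) new ⟩
  2 * allowedDivisors n + 4 * new            ≈⟨ ≡-mod-+-multiple (2 * allowedDivisors n) new ⟩
  2 * allowedDivisors n                      ≈⟨ ≡-mod-sym (B̄₅₄-mod-4 n 0<n) ⟩
  B̄₅₄ n                                      ∎
  where
  open ≡-mod-Reasoning 4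
  instance
    p≢0 : NonZero p
    p≢0 = prime⇒nonZero p-prime

  new = newDivisors p n

  0<p²n : 0 < p * (p * n)
  0<p²n = <-≤-trans 0<n (≤-trans (m≤n*m n p) (m≤n*m (p * n) p))

  distrib : ∀ a x → 2 * (a + 2 * x) ≡ 2 * a + 4 * x
  distrib = ℕ-Solver.solve-∀

-- Primes congruent to 3 modulo 4

≡3-mod-4-≤5 : ∀ {p} → p % 4 ≡ 3 → p ≤ 5 → p ≡ 3
≡3-mod-4-≤5 {0} () _
≡3-mod-4-≤5 {1} () _
≡3-mod-4-≤5 {2} () _
≡3-mod-4-≤5 {3} _  _ = refl
≡3-mod-4-≤5 {4} () _
≡3-mod-4-≤5 {5} () _
≡3-mod-4-≤5 {suc (suc (suc (suc (suc (suc _)))))} _ (s≤s (s≤s (s≤s (s≤s (s≤s ())))))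

coprime-4-5 : ∀ {p} → Prime p → p % 4 ≡ 3 → Coprime 4 p × Coprime 5 p
coprime-4-5 {p} p-prime p≡3 = prime-coprime p-prime (p∤ 4 (n≤1+n 4) (from-no (3 ∣? 4)))
                            , prime-coprime p-prime (p∤ 5 ≤-refl (from-no (3 ∣? 5)))
  where
  p∤ : ∀ q .{{_ : NonZero q}} → q ≤ 5 → 3 ∤ q → p ∤ q
  p∤ q q≤5 3∤q p∣q with ≡3-mod-4-≤5 p≡3 (≤-trans (∣⇒≤ p∣q) q≤5)
  ... | refl = 3∤q p∣q

f-unit : ∀ p → f p ≡ + 1 ⊎ f p ≡ -[1+ 0 ]
f-unit p with (p % 20 ≡ᵇ 3) ∨ (p % 20 ≡ᵇ 7)
... | true  = inj₂ refl
... | false = inj₁ refl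

-- An even y is congruent to −y, so the sign ε does not matter.
4∣x-εy : ∀ {ε x y} s → ε ≡ + 1 ⊎ ε ≡ -[1+ 0 ] → x ≡ y mod 4 → y ≡ 2 * s mod 4 →
         + 4 ∣ℤ (+ x - ε ℤ.* + y)
4∣x-εy {x = x} {y} s (inj₁ refl) (≡-mod 4∣x-y) _ =
  ℤ∣.∣⇒∣ᵤ (subst (λ z → + 4 ℤ∣.∣ (+ x - z)) (sym (ℤ.*-identityˡ (+ y))) 4∣x-y)
4∣x-εy {x = x} {y} s (inj₂ refl) (≡-mod 4∣x-y) (≡-mod 4∣y-2s) =
  ℤ∣.∣⇒∣ᵤ (subst (+ 4 ℤ∣.∣_) eq
    (ℤ∣.∣m∣n⇒∣m+n (ℤ∣.∣m∣n⇒∣m+n 4∣x-y (ℤ∣.∣n⇒∣m*n (+ 2) 4∣y-2s)) (ℤ∣.∣m⇒∣m*n (+ s) ℤ∣.∣-refl)))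
  where
  identity : ∀ a b c → (a - b) ℤ.+ + 2 ℤ.* (b - + 2 ℤ.* c) ℤ.+ + 4 ℤ.* c ≡ a - -[1+ 0 ] ℤ.* b
  identity = ℤ-Solver.solve-∀
  eq : (+ x - + y) ℤ.+ + 2 ℤ.* (+ y - + (2 * s)) ℤ.+ + 4 ℤ.* + s ≡ + x - -[1+ 0 ] ℤ.* + y
  eq = trans (cong (λ z → (+ x - + y) ℤ.+ + 2 ℤ.* (+ y - z) ℤ.+ + 4 ℤ.* + s) (ℤ.pos-* 2 s))
             (identity (+ x) (+ y) (+ s))

argument-factorisation : ∀ p k n q r → 4 * r + 3 ≡ q * p →
            4 * p ^ (suc k + 1) * n + 4 * p * r + 3 * p ≡ p * (p * (4 * p ^ k * n + q))
argument-factorisation p k n q r 4r+3≡qp = begin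
  4 * p ^ (suc k + 1) * n + 4 * p * r + 3 * p ≡⟨ cong (λ e → 4 * p ^ e * n + 4 * p * r + 3 * p)
                                                       (+-comm (suc k) 1) ⟩
  4 * pᵏ⁺² * n + 4 * p * r + 3 * p                ≡⟨ factor-p p pᵏ⁺² n r ⟩
  4 * pᵏ⁺² * n + p * (4 * r + 3)                  ≡⟨ cong (λ m → 4 * pᵏ⁺² * n + p * m) 4r+3≡qp ⟩
  4 * pᵏ⁺² * n + p * (q * p)                      ≡⟨ factor-p² p (p ^ k) n q ⟩
  p * (p * (4 * p ^ k * n + q))                 ∎
  where
  open ≡-Reasoning
  pᵏ⁺² = p * (p * p ^ k)
  factor-p : ∀ p x n r → 4 * x * n + 4 * p * r + 3 * p ≡ 4 * x * n + p * (4 * r + 3)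
  factor-p = ℕ-Solver.solve-∀
  factor-p² : ∀ p x n q → 4 * (p * (p * x)) * n + p * (q * p) ≡ p * (p * (4 * x * n + q))
  factor-p² = ℕ-Solver.solve-∀

theorem6p4 : (k p r : ℕ) → 1 ≤ k → (pp : Prime p) → p % 4 ≡ 3 → p ∣ 4 * r + 3 →
    (n : ℕ) →
    + 4 ∣ℤ (+ B̄₅₄ (4 * p ^ (k + 1) * n + 4 * p * r + 3 * p)
            - (f p Data.Integer.* + B̄₅₄ (4 * p ^ (k ∸ 1) * n + (_/_ (4 * r + 3) p {{prime⇒nonZero pp}}))))
theorem6p4 (suc k) p r _ p-prime p≡3 (divides zero 4r+3≡0) n =
  contradiction 4r+3≡0 (m+1+n≢0 (4 * r))
theorem6p4 (suc k) p r _ p-prime p≡3 (divides (suc q) 4r+3≡qp) n =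
  subst₂ (λ a b → + 4 ∣ℤ (+ B̄₅₄ a - f p ℤ.* + B̄₅₄ b))
         (sym (argument-factorisation p k n (suc q) r 4r+3≡qp))
         (cong (_+_ (4 * p ^ k * n)) (sym 4r+3/p≡q))
         (4∣x-εy (allowedDivisors B) (f-unit p)
                 (B̄₅₄-*-prime² B p-prime 4⊥p 5⊥p 0<B) (B̄₅₄-mod-4 B 0<B))
  where
  instance
    p≢0 : NonZero p
    p≢0 = prime⇒nonZero p-prime
  B = 4 * p ^ k * n + suc q
  0<B : 0 < B
  0<B = <-≤-trans z<s (m≤n+m (suc q) (4 * p ^ k * n))
  4r+3/p≡q : (4 * r + 3) / p ≡ suc q
  4r+3/p≡q = trans (cong (_/ p) 4r+3≡qp) (m*n/n≡m (suc q) p)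
  4⊥p = proj₁ (coprime-4-5 p-prime p≡3)
  5⊥p = proj₂ (coprime-4-5 p-prime p≡3)
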